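{- Let $N$ be a positive integer and $X$ a word set (all of whose words have length at least $N$). If $X$ is the maximal $N$-preimage of $X^{[N]}$, then $X$ is the maximal $M$-preimage of $X^{[M]}$ for every integer $1<M\le N$.
   Context: Words over a finite alphabet may be finite, infinite or bi-infinite; a word set is any set of such words. A projection is a map between alphabets extended letter by letter to words; $Z\succcurlyeq W$ means $\varphi(Z)=W$ for some projection $\varphi$; $Z\sim W$ (similar) means $Z\succcurlyeq W$ and $W\succcurlyeq Z$. The $K$-block presentation $Z^{[K]}$ replaces each word $u$ by the word whose $i$-th letter is the block $[u_iu_{i+1}\dots u_{i+K-1}]$. A $K$-preimage of a word set $V$ is a word set $W$ with $W^{[K]}\sim V$; the maximal $K$-preimage of $V$ is a $K$-preimage $U$ of $V$ with $U\succcurlyeq W$ for every $K$-preimage $W$ of $V$ (unique up to similarity). -}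

module Defs where

open import Data.Nat using (ℕ; zero; suc; _+_; _≤_; _<_)
open import Data.Integer using (ℤ; +_) renaming (_+_ to _+ℤ_)
open import Data.Fin using (Fin; toℕ)
open import Data.List using (List; []; _∷_; length)
open import Data.Vec using (Vec; tabulate)
open import Data.Maybe using (Maybe; just; nothing)
open import Data.Unit using (⊤)
open import Data.Product using (Σ; Σ-syntax; _×_; _,_)
open import Function.Bundles using (_↔_)
open import Relation.Binary.PropositionalEquality using (_≡_)
open import Level using () renaming (suc to lsuc; zero to lzero)

Finite : Set → Set
Finite A = Σ[ n ∈ ℕ ] (Fin n ↔ A)

data Word (A : Set) : Set where
  fin : List A → Word A
  inf : (ℕ → A) → Word A
  bi  : (ℤ → A) → Word A

data _≈w_ {A : Set} : Word A → Word A → Set where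
  fin≈ : {u v : List A} → u ≡ v → fin u ≈w fin v
  inf≈ : {f g : ℕ → A} → (∀ i → f i ≡ g i) → inf f ≈w inf g
  bi≈  : {f g : ℤ → A} → (∀ i → f i ≡ g i) → bi f ≈w bi g

WordSet : Set → Set₁
WordSet A = Word A → Set

mapList : {A B : Set} → (A → B) → List A → List B
mapList φ [] = []
mapList φ (a ∷ u) = φ a ∷ mapList φ u

mapW : {A B : Set} → (A → B) → Word A → Word B
mapW φ (fin u) = fin (mapList φ u)
mapW φ (inf f) = inf (λ i → φ (f i))
mapW φ (bi f)  = bi (λ i → φ (f i))

ImageIs : {A B : Set} → (Word A → Word B) → WordSet A → WordSet B → Set
ImageIs F Z W =
  (∀ z → Z z → Σ[ w ∈ Word _ ] (W w × F z ≈w w)) ×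
  (∀ w → W w → Σ[ z ∈ Word _ ] (Z z × F z ≈w w))

_≽_ : {A B : Set} → WordSet A → WordSet B → Set
_≽_ {A} {B} Z W = Σ[ φ ∈ (A → B) ] ImageIs (mapW φ) Z W

_∼_ : {A B : Set} → WordSet A → WordSet B → Set
Z ∼ W = (Z ≽ W) × (W ≽ Z)

takeV : {A : Set} (K : ℕ) → List A → Maybe (Vec A K)
takeV zero u = just Data.Vec.[]
takeV (suc K) [] = nothing
takeV (suc K) (a ∷ u) with takeV K u
... | nothing = nothing
... | just v  = just (a Data.Vec.∷ v)

-- the list of all length-K factors u_i … u_{i+K-1}, in order
blocksL : {A : Set} (K : ℕ) → List A → List (Vec A K)
blocksL K [] = []
blocksL K (a ∷ u) with takeV K (a ∷ u)
... | nothing = []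
... | just v  = v ∷ blocksL K u

blockW : {A : Set} (K : ℕ) → Word A → Word (Vec A K)
blockW K (fin u) = fin (blocksL K u)
blockW K (inf f) = inf (λ i → tabulate (λ j → f (i + toℕ j)))
blockW K (bi f)  = bi (λ i → tabulate (λ j → f (i +ℤ + toℕ j)))

_^[_] : {A : Set} → WordSet A → (K : ℕ) → WordSet (Vec A K)
(Z ^[ K ]) w = Σ[ z ∈ Word _ ] (Z z × blockW K z ≈w w)

LongEnough : {A : Set} → ℕ → Word A → Set
LongEnough K (fin u) = K ≤ length u
LongEnough K (inf f) = ⊤
LongEnough K (bi f)  = ⊤

AllLongEnough : {A : Set} → ℕ → WordSet A → Set
AllLongEnough {A} K W = ∀ (w : Word A) → W w → LongEnough K w

IsPreimage : {B C : Set} → ℕ → WordSet C → WordSet B → Set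
IsPreimage K V W = AllLongEnough K W × ((W ^[ K ]) ∼ V)

IsMaximalPreimage : {A C : Set} → ℕ → WordSet C → WordSet A → Set₁
IsMaximalPreimage K V U =
  IsPreimage K V U ×
  (∀ (B : Set) → Finite B → (W : WordSet B) → IsPreimage K V W → U ≽ W)

module Submission where

-- A sliding block code on M-blocks extends to one on N-blocks whenever M ≤ N: every
-- position of an N-block lies in some M-window inside it, so its image letter can be
-- read off from the image of that window. Hence W^[M] ∼ X^[M] implies W^[N] ∼ X^[N]
-- (and the length bound N transfers from X to W), i.e. every M-preimage of X^[M] is an
-- N-preimage of X^[N], which X dominates by N-maximality.

open import Defs
open import Data.Nat using (ℕ; zero; suc; _+_; _∸_; _<_; _≤_; z≤n; s≤s; s≤s⁻¹; _≤?_)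
open import Data.Nat.Properties
open import Data.Integer using (ℤ) renaming (_+_ to _+ℤ_; +_ to pos)
import Data.Integer.Properties as ℤ
open import Data.Fin using (Fin; toℕ; fromℕ<) renaming (zero to fzero)
open import Data.Fin.Properties using (toℕ-fromℕ<; toℕ<n)
open import Data.List using (List; []; _∷_; length; map; applyUpTo)
open import Data.List.Properties using (map-id; length-map; length-applyUpTo; map-applyUpTo; ∷-injective)
open import Data.Vec using (Vec; tabulate; lookup)
open import Data.Vec.Properties using (lookup∘tabulate; tabulate-cong)
open import Data.Maybe using (just; nothing)
open import Data.Unit using (tt)
open import Data.Product using (Σ-syntax; _×_; _,_; proj₁; proj₂)
open import Function using (_∘_; id)
open import Relation.Binary.PropositionalEquality
open import Relation.Nullary using (yes; no)

private
  variable
    A B : Set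

≈w-refl : (w : Word A) → w ≈w w
≈w-refl (fin u) = fin≈ refl
≈w-refl (inf f) = inf≈ (λ _ → refl)
≈w-refl (bi f)  = bi≈ (λ _ → refl)

≈w-sym : {w v : Word A} → w ≈w v → v ≈w w
≈w-sym (fin≈ p) = fin≈ (sym p)
≈w-sym (inf≈ p) = inf≈ (λ i → sym (p i))
≈w-sym (bi≈ p)  = bi≈ (λ i → sym (p i))

≈w-trans : {w v t : Word A} → w ≈w v → v ≈w t → w ≈w t
≈w-trans (fin≈ p) (fin≈ q) = fin≈ (trans p q)
≈w-trans (inf≈ p) (inf≈ q) = inf≈ (λ i → trans (p i) (q i))
≈w-trans (bi≈ p)  (bi≈ q)  = bi≈ (λ i → trans (p i) (q i))

mapList≡map : (φ : A → B) (u : List A) → mapList φ u ≡ map φ u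
mapList≡map φ []      = refl
mapList≡map φ (a ∷ u) = cong (φ a ∷_) (mapList≡map φ u)

mapW-cong : (φ : A → B) {w v : Word A} → w ≈w v → mapW φ w ≈w mapW φ v
mapW-cong φ (fin≈ p) = fin≈ (cong (mapList φ) p)
mapW-cong φ (inf≈ p) = inf≈ (λ i → cong φ (p i))
mapW-cong φ (bi≈ p)  = bi≈ (λ i → cong φ (p i))

mapW-id : (w : Word A) → mapW id w ≈w w
mapW-id (fin u) = fin≈ (trans (mapList≡map id u) (map-id u))
mapW-id (inf f) = inf≈ (λ _ → refl)
mapW-id (bi f)  = bi≈ (λ _ → refl)

≽-refl : (Z : WordSet A) → Z ≽ Z
≽-refl Z = id , (λ z z∈Z → z , z∈Z , mapW-id z) , (λ w w∈Z → w , w∈Z , mapW-id w)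

AllLongEnough-mono : ∀ {M N} {X : WordSet A} → M ≤ N → AllLongEnough N X → AllLongEnough M X
AllLongEnough-mono M≤N long (fin u) u∈X = ≤-trans M≤N (long (fin u) u∈X)
AllLongEnough-mono M≤N long (inf f) _   = tt
AllLongEnough-mono M≤N long (bi f)  _   = tt

applyUpTo-cong : ∀ {f g : ℕ → A} n → (∀ i → i < n → f i ≡ g i) → applyUpTo f n ≡ applyUpTo g n
applyUpTo-cong zero    f≗g = refl
applyUpTo-cong (suc n) f≗g = cong₂ _∷_ (f≗g 0 (s≤s z≤n)) (applyUpTo-cong n (λ i i<n → f≗g (suc i) (s≤s i<n)))

applyUpTo-injective : ∀ {f g : ℕ → A} m n → applyUpTo f m ≡ applyUpTo g n →
                      m ≡ n × (∀ i → i < m → f i ≡ g i)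
applyUpTo-injective {f = f} {g} m n eq =
  trans (sym (length-applyUpTo f m)) (trans (cong length eq) (length-applyUpTo g n)) , pointwise m n eq
  where
    pointwise : ∀ {f g : ℕ → A} m n → applyUpTo f m ≡ applyUpTo g n → ∀ i → i < m → f i ≡ g i
    pointwise (suc m) (suc n) eq zero    _         = proj₁ (∷-injective eq)
    pointwise (suc m) (suc n) eq (suc i) (s≤s i<m) = pointwise m n (proj₂ (∷-injective eq)) i i<m

window : (K : ℕ) → (ℕ → A) → ℕ → Vec A K
window K f i = tabulate (λ j → f (i + toℕ j))

-- Positions beyond the end of u read the default letter d.
at : A → List A → ℕ → A
at d []      i       = d
at d (a ∷ u) zero    = a
at d (a ∷ u) (suc i) = at d u i

takeV-long : (d : A) (K : ℕ) (u : List A) → K ≤ length u → takeV K u ≡ just (window K (at d u) 0)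
takeV-long d zero    u       _         = refl
takeV-long d (suc K) (a ∷ u) (s≤s K≤u) rewrite takeV-long d K u K≤u = refl

takeV-short : ∀ K (u : List A) → length u < K → takeV K u ≡ nothing
takeV-short (suc K) []      _         = refl
takeV-short (suc K) (a ∷ u) (s≤s u<K) rewrite takeV-short K u u<K = refl

blocksL-applyUpTo : (d : A) (K : ℕ) (u : List A) →
                    blocksL (suc K) u ≡ applyUpTo (window (suc K) (at d u)) (length u ∸ K)
blocksL-applyUpTo d K [] rewrite 0∸n≡0 K = refl
blocksL-applyUpTo d K (a ∷ u) with K ≤? length u
... | yes K≤u rewrite takeV-long d K u K≤u | +-∸-assoc 1 K≤u =
  cong (window (suc K) (at d (a ∷ u)) 0 ∷_) (blocksL-applyUpTo d K u)
... | no K≰u rewrite takeV-short K u (≰⇒> K≰u) | m≤n⇒m∸n≡0 (≰⇒> K≰u) = refl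

length-blocksL : ∀ K (u : List A) → length (blocksL (suc K) u) ≡ length u ∸ K
length-blocksL K []      = sym (0∸n≡0 K)
length-blocksL K (a ∷ u) = trans (cong length (blocksL-applyUpTo a K (a ∷ u))) (length-applyUpTo _ _)

blocksL-short : ∀ K (u : List A) → length u ≤ K → blocksL (suc K) u ≡ []
blocksL-short K []      _   = refl
blocksL-short K (a ∷ u) u≤K rewrite takeV-short K u u≤K = refl

blocksL-≡[]-mono : ∀ {m n} (u : List A) → m ≤ n → blocksL (suc m) u ≡ [] → blocksL (suc n) u ≡ []
blocksL-≡[]-mono {m = m} {n} u m≤n eq =
  blocksL-short n u (≤-trans (m∸n≡0⇒m≤n (trans (sym (length-blocksL m u)) (cong length eq))) m≤n)

mapList-≡[] : (φ : A → B) (u : List A) → mapList φ u ≡ [] → u ≡ []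
mapList-≡[] φ [] _ = refl

window-shiftℤ : (K : ℕ) (f : ℤ → A) (i : ℤ) (s : ℕ) →
                window K (λ k → f (i +ℤ pos k)) s ≡ tabulate (λ k → f (i +ℤ pos s +ℤ pos (toℕ k)))
window-shiftℤ K f i s = tabulate-cong λ k →
  cong f (trans (cong (i +ℤ_) (ℤ.pos-+ s (toℕ k))) (sym (ℤ.+-assoc i (pos s) (pos (toℕ k)))))

record Covering (M N j : ℕ) : Set where
  field
    start  : ℕ
    offset : Fin M
    fits   : start + M ≤ N
    covers : start + toℕ offset ≡ j

covering : ∀ {m N} → suc m ≤ N → ∀ j → j < N → Covering (suc m) N j
covering {m} {N} M≤N j j<N with j ≤? N ∸ suc m
... | yes j≤N-M = record
  { start  = j
  ; offset = fzero
  ; fits   = ≤-trans (+-monoˡ-≤ (suc m) j≤N-M) (≤-reflexive (m∸n+n≡m M≤N))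
  ; covers = +-identityʳ j
  }
... | no j≰N-M = record
  { start  = N ∸ suc m
  ; offset = fromℕ< r<M
  ; fits   = ≤-reflexive (m∸n+n≡m M≤N)
  ; covers = trans (cong ((N ∸ suc m) +_) (toℕ-fromℕ< r<M)) (m+[n∸m]≡n (<⇒≤ (≰⇒> j≰N-M)))
  }
  where
    r<M : j ∸ (N ∸ suc m) < suc m
    r<M = m<n+o⇒m∸n<o j (N ∸ suc m) (subst (j <_) (sym (m∸n+n≡m M≤N)) j<N)

start+k<N : ∀ {M N j} (C : Covering M N j) (k : Fin M) → Covering.start C + toℕ k < N
start+k<N C k = ≤-trans (+-monoʳ-< (Covering.start C) (toℕ<n k)) (Covering.fits C)

sub-window-fits : ∀ {m n} L i s → i < L ∸ n → s + suc m ≤ suc n → i + s < L ∸ m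
sub-window-fits {m} {n} L i s i<L-n s+M≤N = m+n≤o⇒m≤o∸n (suc (i + s)) (begin
  suc (i + s) + m   ≡⟨ cong suc (+-assoc i s m) ⟩
  suc i + (s + m)   ≤⟨ +-monoʳ-≤ (suc i) (s≤s⁻¹ (subst (_≤ suc n) (+-suc s m) s+M≤N)) ⟩
  suc i + n         ≤⟨ m≤o∸n⇒m+n≤o (suc i) (<⇒≤ n<L) i<L-n ⟩
  L                 ∎)
  where
    open ≤-Reasoning
    n<L : n < L
    n<L = m∸n≢0⇒n<m (λ L-n≡0 → n≮0 (subst (i <_) L-n≡0 i<L-n))

module _ {m n : ℕ} (m≤n : m ≤ n) {A B : Set} (φ : Vec A (suc m) → Vec B (suc m)) where

  private
    M N : ℕ
    M = suc m
    N = suc n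

  liftBlockMap : Vec A N → Vec B N
  liftBlockMap v = tabulate λ j →
    let C = covering (s≤s m≤n) (toℕ j) (toℕ<n j) in
    lookup (φ (tabulate λ k → lookup v (fromℕ< (start+k<N C k)))) (Covering.offset C)

  lift-window : (f : ℕ → A) (g : ℕ → B) (i : ℕ) →
                (∀ s → s + M ≤ N → φ (window M f (i + s)) ≡ window M g (i + s)) →
                liftBlockMap (window N f i) ≡ window N g i
  lift-window f g i hyp = tabulate-cong λ j →
    let C = covering (s≤s m≤n) (toℕ j) (toℕ<n j)
        open Covering C in
    begin
      lookup (φ (tabulate λ k → lookup (window N f i) (fromℕ< (start+k<N C k)))) offset
        ≡⟨ cong (λ v → lookup (φ v) offset) (tabulate-cong λ k →
             trans (lookup∘tabulate (λ t → f (i + toℕ t)) (fromℕ< (start+k<N C k)))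
                   (cong (λ t → f (i + t)) (toℕ-fromℕ< (start+k<N C k)))) ⟩
      lookup (φ (tabulate λ k → f (i + (start + toℕ k)))) offset
        ≡⟨ cong (λ v → lookup (φ v) offset) (tabulate-cong λ k → cong f (sym (+-assoc i start (toℕ k)))) ⟩
      lookup (φ (window M f (i + start))) offset
        ≡⟨ cong (λ v → lookup v offset) (hyp start fits) ⟩
      lookup (window M g (i + start)) offset
        ≡⟨ lookup∘tabulate (λ k → g (i + start + toℕ k)) offset ⟩
      g (i + start + toℕ offset)
        ≡⟨ cong g (trans (+-assoc i start (toℕ offset)) (cong (i +_) covers)) ⟩
      g (i + toℕ j)
    ∎
    where open ≡-Reasoning

  lift-blocksL : (d : A) (e : B) (u : List A) (y : List B) →
                 map φ (blocksL M u) ≡ blocksL M y → map liftBlockMap (blocksL N u) ≡ blocksL N y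
  lift-blocksL d e u y hyp = begin
    map liftBlockMap (blocksL N u)
      ≡⟨ cong (map liftBlockMap) (blocksL-applyUpTo d n u) ⟩
    map liftBlockMap (applyUpTo (window N (at d u)) (length u ∸ n))
      ≡⟨ map-applyUpTo _ liftBlockMap (length u ∸ n) ⟩
    applyUpTo (liftBlockMap ∘ window N (at d u)) (length u ∸ n)
      ≡⟨ applyUpTo-cong (length u ∸ n) blocks-agree ⟩
    applyUpTo (window N (at e y)) (length u ∸ n)
      ≡⟨ cong (applyUpTo (window N (at e y))) lengths-agree ⟩
    applyUpTo (window N (at e y)) (length y ∸ n)
      ≡⟨ blocksL-applyUpTo e n y ⟨
    blocksL N y
    ∎
    where
      open ≡-Reasoning
      M-windows : applyUpTo (φ ∘ window M (at d u)) (length u ∸ m)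
                ≡ applyUpTo (window M (at e y)) (length y ∸ m)
      M-windows = begin
        applyUpTo (φ ∘ window M (at d u)) (length u ∸ m)   ≡⟨ map-applyUpTo _ φ _ ⟨
        map φ (applyUpTo (window M (at d u)) (length u ∸ m)) ≡⟨ cong (map φ) (blocksL-applyUpTo d m u) ⟨
        map φ (blocksL M u)                                  ≡⟨ hyp ⟩
        blocksL M y                                          ≡⟨ blocksL-applyUpTo e m y ⟩
        applyUpTo (window M (at e y)) (length y ∸ m)         ∎
      lengths-agree : length u ∸ n ≡ length y ∸ n
      lengths-agree = begin
        length u ∸ n         ≡⟨ cong (length u ∸_) m+o≡n ⟨
        length u ∸ (m + o)   ≡⟨ ∸-+-assoc (length u) m o ⟨
        length u ∸ m ∸ o     ≡⟨ cong (_∸ o) (proj₁ (applyUpTo-injective _ _ M-windows)) ⟩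
        length y ∸ m ∸ o     ≡⟨ ∸-+-assoc (length y) m o ⟩
        length y ∸ (m + o)   ≡⟨ cong (length y ∸_) m+o≡n ⟩
        length y ∸ n         ∎
        where
          o : ℕ
          o = proj₁ (m≤n⇒∃[o]m+o≡n m≤n)
          m+o≡n : m + o ≡ n
          m+o≡n = proj₂ (m≤n⇒∃[o]m+o≡n m≤n)
      blocks-agree : ∀ i → i < length u ∸ n → liftBlockMap (window N (at d u) i) ≡ window N (at e y) i
      blocks-agree i i<u-n = lift-window (at d u) (at e y) i λ s s+M≤N →
        proj₂ (applyUpTo-injective _ _ M-windows) (i + s) (sub-window-fits (length u) i s i<u-n s+M≤N)

  lift-blockW : (w : Word A) (x : Word B) →
                mapW φ (blockW M w) ≈w blockW M x → mapW liftBlockMap (blockW N w) ≈w blockW N x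
  -- The empty-word cases are split off only because `at` needs a default letter.
  lift-blockW (fin []) (fin y) (fin≈ p) = fin≈ (sym (blocksL-≡[]-mono y m≤n (sym p)))
  lift-blockW (fin u@(_ ∷ _)) (fin []) (fin≈ p) =
    fin≈ (cong (mapList liftBlockMap) (blocksL-≡[]-mono u m≤n (mapList-≡[] φ _ p)))
  lift-blockW (fin u@(a ∷ _)) (fin y@(c ∷ _)) (fin≈ p) =
    fin≈ (trans (mapList≡map liftBlockMap _) (lift-blocksL a c u y (trans (sym (mapList≡map φ _)) p)))
  lift-blockW (inf f) (inf g) (inf≈ p) = inf≈ λ i → lift-window f g i (λ s _ → p (i + s))
  lift-blockW (bi f) (bi g) (bi≈ p) = bi≈ λ i →
    lift-window (λ k → f (i +ℤ pos k)) (λ k → g (i +ℤ pos k)) 0 λ s _ → begin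
      φ (window M (λ k → f (i +ℤ pos k)) s)               ≡⟨ cong φ (window-shiftℤ M f i s) ⟩
      φ (tabulate (λ k → f (i +ℤ pos s +ℤ pos (toℕ k))))  ≡⟨ p (i +ℤ pos s) ⟩
      tabulate (λ k → g (i +ℤ pos s +ℤ pos (toℕ k)))      ≡⟨ window-shiftℤ M g i s ⟨
      window M (λ k → g (i +ℤ pos k)) s                   ∎
    where open ≡-Reasoning

  lift-image : {P : WordSet A} {Q : WordSet B} →
               ImageIs (mapW φ) (P ^[ M ]) (Q ^[ M ]) → ImageIs (mapW liftBlockMap) (P ^[ N ]) (Q ^[ N ])
  lift-image {P} {Q} (forth , back) = forth′ , back′
    where
      forth′ : ∀ z → (P ^[ N ]) z → Σ[ w ∈ Word (Vec B N) ] ((Q ^[ N ]) w × mapW liftBlockMap z ≈w w)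
      forth′ z (p , p∈P , p≈z) with forth (blockW M p) (p , p∈P , ≈w-refl _)
      ... | _ , (q , q∈Q , q≈) , φp≈ =
        blockW N q , (q , q∈Q , ≈w-refl _) ,
        ≈w-trans (mapW-cong liftBlockMap (≈w-sym p≈z)) (lift-blockW p q (≈w-trans φp≈ (≈w-sym q≈)))
      back′ : ∀ w → (Q ^[ N ]) w → Σ[ z ∈ Word (Vec A N) ] ((P ^[ N ]) z × mapW liftBlockMap z ≈w w)
      back′ w (q , q∈Q , q≈w) with back (blockW M q) (q , q∈Q , ≈w-refl _)
      ... | _ , (p , p∈P , p≈) , φ≈q =
        blockW N p , (p , p∈P , ≈w-refl _) ,
        ≈w-trans (lift-blockW p q (≈w-trans (mapW-cong φ p≈) φ≈q)) q≈w

length-blocksL-injective : ∀ m (u : List A) (y : List B) → suc m ≤ length u →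
                           length (blocksL (suc m) u) ≡ length (blocksL (suc m) y) → length u ≡ length y
length-blocksL-injective m u y M≤u eq = ∸-cancelʳ-≡ (<⇒≤ M≤u) (<⇒≤ m<y) u-m≡y-m
  where
    u-m≡y-m : length u ∸ m ≡ length y ∸ m
    u-m≡y-m = trans (sym (length-blocksL m u)) (trans eq (length-blocksL m y))
    m<y : m < length y
    m<y = m∸n≢0⇒n<m (λ y-m≡0 → n≮0 (subst (0 <_) (trans u-m≡y-m y-m≡0) (m<n⇒0<n∸m M≤u)))

LongEnough-reflect : ∀ {m N} (φ : Vec A (suc m) → Vec B (suc m)) (u : List A) (x : Word B) →
                     suc m ≤ length u → LongEnough N x →
                     mapW φ (blockW (suc m) (fin u)) ≈w blockW (suc m) x → LongEnough N (fin u)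
LongEnough-reflect {m = m} {N} φ u (fin y) M≤u N≤y (fin≈ p) =
  subst (N ≤_) (sym (length-blocksL-injective m u y M≤u same-length)) N≤y
  where
    same-length : length (blocksL (suc m) u) ≡ length (blocksL (suc m) y)
    same-length = trans (sym (length-map φ (blocksL (suc m) u)))
                        (trans (cong length (sym (mapList≡map φ (blocksL (suc m) u)))) (cong length p))

preimage-lift : ∀ {m n} → m ≤ n → {X : WordSet A} {W : WordSet B} → AllLongEnough (suc n) X →
                IsPreimage (suc m) (X ^[ suc m ]) W → IsPreimage (suc n) (X ^[ suc n ]) W
preimage-lift {m = m} {n} m≤n {W = W} longX (longW , (φ , imgφ) , (ψ , imgψ)) =
  longW′ , (liftBlockMap m≤n φ , lift-image m≤n φ imgφ) , (liftBlockMap m≤n ψ , lift-image m≤n ψ imgψ)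
  where
    longW′ : AllLongEnough (suc n) W
    longW′ (fin u) u∈W with proj₁ imgφ (blockW (suc m) (fin u)) (fin u , u∈W , ≈w-refl _)
    ... | _ , (x , x∈X , x≈) , φu≈ =
      LongEnough-reflect φ u x (longW (fin u) u∈W) (longX x x∈X) (≈w-trans φu≈ (≈w-sym x≈))
    longW′ (inf f) _ = tt
    longW′ (bi f)  _ = tt

corollary3 : (N : ℕ) → 0 < N → (A : Set) → Finite A → (X : WordSet A) →
    AllLongEnough N X →
    IsMaximalPreimage N (X ^[ N ]) X →
    (M : ℕ) → 1 < M → M ≤ N → IsMaximalPreimage M (X ^[ M ]) X
corollary3 _ _ _ _ _ _ _ zero () _
corollary3 _ _ _ _ _ longX (_ , maximalN) (suc m) _ (s≤s m≤n) =
  (AllLongEnough-mono (s≤s m≤n) longX , ≽-refl _ , ≽-refl _) ,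
  λ B finB W W-preimage → maximalN B finB W (preimage-lift m≤n longX W-preimage)
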